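{- Let $k\in\mathbb{N}_0$ and let $G \in F(\chi,k)$. Then $2\chi(G) - 2 \leq \Delta(G) \leq 2k+2$. Moreover, $2 \leq \chi(G) \leq k+2$.
   Context: All graphs are finite and simple. $\Delta(H)$ denotes the maximum degree, $\chi(H)$ the chromatic number of $H$. For $k\in\mathbb{N}_0$, $\varUpsilon_k$ is the class of graphs $G$ such that every induced subgraph $H$ of $G$ (including $G$ itself) satisfies $\Delta(H)\le \chi(H)+k-1$. $F(\chi,k)$ denotes the set of minimal forbidden induced subgraphs of $\varUpsilon_k$: $F\in F(\chi,k)$ iff $F\notin\varUpsilon_k$ and every proper induced subgraph of $F$ lies in $\varUpsilon_k$. -}

module Defs where

open import Data.Nat using (ℕ; zero; suc; _+_; _≤_; _<_; _⊔_)
open import Data.Bool using (Bool; true; false; if_then_else_)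
open import Data.Fin using (Fin)
open import Data.List using (List; map; foldr; allFin)
open import Data.Nat.ListAction using (sum)
open import Data.Product using (Σ; _×_)
open import Relation.Binary.PropositionalEquality using (_≡_; _≢_)
open import Relation.Nullary using (¬_)
open import Function.Definitions using (Injective)

record Graph (n : ℕ) : Set where
  field
    adj   : Fin n → Fin n → Bool
    sym   : ∀ u v → adj u v ≡ adj v u
    irrefl : ∀ v → adj v v ≡ false
open Graph public

deg : ∀ {n} → Graph n → Fin n → ℕ
deg {n} G v = sum (map (λ u → if adj G v u then 1 else 0) (allFin n))

-- maximum degree Δ(G) (0 for the graph with no vertices)
Δ : ∀ {n} → Graph n → ℕ
Δ {n} G = foldr _⊔_ 0 (map (deg G) (allFin n))

ProperColouring : ∀ {n} → Graph n → (c : ℕ) → (Fin n → Fin c) → Set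
ProperColouring G c col = ∀ u v → adj G u v ≡ true → col u ≢ col v

Colourable : ∀ {n} → Graph n → ℕ → Set
Colourable {n} G c = Σ (Fin n → Fin c) (ProperColouring G c)

IsChromaticNumber : ∀ {n} → Graph n → ℕ → Set
IsChromaticNumber G c = Colourable G c × (∀ d → Colourable G d → c ≤ d)

induced : ∀ {n m} (G : Graph n) → (Fin m → Fin n) → Graph m
induced G f = record
  { adj = λ i j → adj G (f i) (f j)
  ; sym = λ i j → sym G (f i) (f j)
  ; irrefl = λ i → irrefl G (f i) }

-- G ∈ Υ_k : every (nonempty) induced subgraph H satisfies Δ(H) ≤ χ(H) + k - 1,
-- written as Δ(H) + 1 ≤ χ(H) + k to avoid truncated subtraction.
Upsilon : ℕ → ∀ {n} → Graph n → Set
Upsilon k {n} G =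
  ∀ m (f : Fin (suc m) → Fin n) → Injective _≡_ _≡_ f →
  ∀ c → IsChromaticNumber (induced G f) c → Δ (induced G f) + 1 ≤ c + k

MinForbidden : ℕ → ∀ {n} → Graph n → Set
MinForbidden k {n} G =
  ¬ Upsilon k G ×
  (∀ m (f : Fin (suc m) → Fin n) → Injective _≡_ _≡_ f → suc m < n →
     Upsilon k (induced G f))

module Submission where

-- Let G ∈ F(χ,k) have N = n + 1 vertices and chromatic number c.
--  (1) c + k ≤ Δ(G): otherwise G ∈ Υ_k, because an induced subgraph on fewer
--      vertices lies in Υ_k by minimality, and one on all N vertices is a
--      relabelling of G, with the same chromatic number and no larger Δ.
--  (2) Fix v of maximum degree and u ≠ v.  As G - u ∈ Υ_k,
--        c + k ≤ deg v ≤ [v ~ u] + Δ(G - u) ≤ [v ~ u] + χ(G - u) + k - 1,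
--      and χ(G - u) ≤ c; hence v ~ u, χ(G - u) = c and Δ(G) ≤ c + k.
--      So Δ(G) = c + k = n, v is universal, and a one-vertex G is impossible.
--  (3) An edge forces c ≥ 2.  In an optimal colouring every colour other than
--      that of v is used twice (else dropping that class, or its single vertex
--      u ≠ v, would save a colour); so N ≥ 2c - 1, i.e. c ≤ k + 2.
--  (4) Arithmetic turns Δ = c + k and 2 ≤ c ≤ k + 2 into the stated bounds.

open import Defs hiding (sym)
open import Data.Nat using (ℕ; zero; suc; _*_; _+_; _∸_; _≤_; _<_; _⊔_; z≤n; s≤s; _≤?_)
open import Data.Nat.Properties hiding (_≟_)
open import Data.Nat.Tactic.RingSolver using (solve-∀)
open import Data.Bool using (Bool; true; false; if_then_else_)
import Data.Bool.Properties as Bool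
open import Data.Fin using (Fin; zero; suc; punchIn; punchOut; inject≤; splitAt; join; finToFun; funToFin)
import Data.Fin.Properties as Fin
open import Data.Fin.Properties using (punchIn-injective; punchInᵢ≢i; punchIn-punchOut; punchOut-injective; inject≤-injective; injective⇒≤; join-splitAt; finToFun-funToFin; any?; all?; _≟_)
import Data.List as List
open import Data.List.Properties using (map-tabulate)
import Data.Vec.Functional as Vector
open import Data.Product using (∃; _×_; _,_; proj₁; proj₂)
open import Data.Sum using (_⊎_; inj₁; inj₂; reduce)
open import Data.Empty using (⊥-elim)
open import Relation.Binary.PropositionalEquality using (_≡_; _≢_; _≗_; refl; sym; trans; cong; cong₂; subst; subst₂; module ≡-Reasoning)
open import Relation.Nullary using (Dec; yes; no; ¬_; ¬?; _→-dec_)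
open import Function using (_∘_; id)
open import Function.Definitions using (Injective)
open import Algebra.Properties.CommutativeMonoid.Sum +-0-commutativeMonoid using (sum; sum-remove; sum-cong-≗)

foldr-allFin : ∀ {A B : Set} {n} (_∙_ : A → B → B) (e : B) (t : Fin n → A) →
  List.foldr _∙_ e (List.map t (List.allFin n)) ≡ Vector.foldr _∙_ e t
foldr-allFin {A} {B} {n} _∙_ e t =
  trans (cong (List.foldr _∙_ e) (map-tabulate id t)) (foldr-tabulate n t)
  where
  foldr-tabulate : ∀ n (t : Fin n → A) → List.foldr _∙_ e (List.tabulate t) ≡ Vector.foldr _∙_ e t
  foldr-tabulate zero    t = refl
  foldr-tabulate (suc n) t = cong (t zero ∙_) (foldr-tabulate n (t ∘ suc))

sum-ones : ∀ n → sum (λ (_ : Fin n) → 1) ≡ n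
sum-ones zero    = refl
sum-ones (suc n) = cong suc (sum-ones n)

sum-reindex-≤ : ∀ {m n} (t : Fin n → ℕ) (f : Fin m → Fin n) →
  Injective _≡_ _≡_ f → sum (t ∘ f) ≤ sum t
sum-reindex-≤ {zero}          t f f-inj = z≤n
sum-reindex-≤ {suc m} {zero}  t f f-inj with f zero
... | ()
sum-reindex-≤ {suc m} {suc n} t f f-inj = begin
  t (f zero) + sum (t ∘ f ∘ suc)
    ≡⟨ cong (t (f zero) +_) (sum-cong-≗ (λ j → cong t (sym (punchIn-punchOut (avoids j))))) ⟩
  t (f zero) + sum (t ∘ punchIn (f zero) ∘ g)
    ≤⟨ +-monoʳ-≤ (t (f zero)) (sum-reindex-≤ (t ∘ punchIn (f zero)) g g-inj) ⟩
  t (f zero) + sum (t ∘ punchIn (f zero))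
    ≡⟨ sym (sum-remove t) ⟩
  sum t ∎
  where
  open ≤-Reasoning
  avoids : ∀ j → f zero ≢ f (suc j)
  avoids j eq with f-inj eq
  ... | ()
  g : Fin m → Fin n
  g j = punchOut (avoids j)
  g-inj : Injective _≡_ _≡_ g
  g-inj eq = Fin.suc-injective (f-inj (punchOut-injective (avoids _) (avoids _) eq))

maximum : ∀ {n} → (Fin n → ℕ) → ℕ
maximum = Vector.foldr _⊔_ 0

≤-maximum : ∀ {n} (t : Fin n → ℕ) i → t i ≤ maximum t
≤-maximum t zero    = m≤m⊔n (t zero) _
≤-maximum t (suc i) = ≤-trans (≤-maximum (t ∘ suc) i) (m≤n⊔m (t zero) _)

maximum-≤ : ∀ {n} (t : Fin n → ℕ) {b} → (∀ i → t i ≤ b) → maximum t ≤ b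
maximum-≤ {zero}  t t≤b = z≤n
maximum-≤ {suc n} t t≤b = ⊔-lub (t≤b zero) (maximum-≤ (t ∘ suc) (t≤b ∘ suc))

maximum-attained : ∀ {n} (t : Fin (suc n) → ℕ) → ∃ λ i → t i ≡ maximum t
maximum-attained {zero}  t = zero , sym (⊔-identityʳ (t zero))
maximum-attained {suc n} t with ⊔-sel (t zero) (maximum (t ∘ suc))
... | inj₁ eq = zero , sym eq
... | inj₂ eq with maximum-attained (t ∘ suc)
...   | i , eq′ = suc i , trans eq′ (sym eq)

link : ∀ {n} → Graph n → Fin n → Fin n → ℕ
link G u v = if adj G u v then 1 else 0

link≤1 : ∀ {n} (G : Graph n) u v → link G u v ≤ 1
link≤1 G u v with adj G u v
... | true  = ≤-refl
... | false = z≤n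

deg-sum : ∀ {n} (G : Graph n) v → deg G v ≡ sum (link G v)
deg-sum G v = foldr-allFin _+_ 0 (link G v)

Δ-maximum : ∀ {n} (G : Graph n) → Δ G ≡ maximum (deg G)
Δ-maximum G = foldr-allFin _⊔_ 0 (deg G)

deg≤Δ : ∀ {n} (G : Graph n) v → deg G v ≤ Δ G
deg≤Δ G v = subst (deg G v ≤_) (sym (Δ-maximum G)) (≤-maximum (deg G) v)

maxDegreeVertex : ∀ {n} (G : Graph (suc n)) → ∃ λ v → deg G v ≡ Δ G
maxDegreeVertex G with maximum-attained (deg G)
... | v , eq = v , trans eq (sym (Δ-maximum G))

Δ-induced-≤ : ∀ {m n} (G : Graph n) (f : Fin m → Fin n) → Injective _≡_ _≡_ f →
  Δ (induced G f) ≤ Δ G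
Δ-induced-≤ G f f-inj = subst (_≤ Δ G) (sym (Δ-maximum (induced G f)))
  (maximum-≤ (deg (induced G f)) deg-i≤Δ)
  where
  deg-i≤Δ : ∀ i → deg (induced G f) i ≤ Δ G
  deg-i≤Δ i = begin
    deg (induced G f) i  ≡⟨ deg-sum (induced G f) i ⟩
    sum (link G (f i) ∘ f) ≤⟨ sum-reindex-≤ (link G (f i)) f f-inj ⟩
    sum (link G (f i))   ≡⟨ sym (deg-sum G (f i)) ⟩
    deg G (f i)          ≤⟨ deg≤Δ G (f i) ⟩
    Δ G ∎
    where open ≤-Reasoning

delete : ∀ {n} → Graph (suc n) → Fin (suc n) → Graph n
delete G u = induced G (punchIn u)

deg-delete : ∀ {n} (G : Graph (suc n)) {u v} (u≢v : u ≢ v) →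
  deg G v ≡ link G v u + deg (delete G u) (punchOut u≢v)
deg-delete {n} G {u} {v} u≢v = begin
  deg G v                                  ≡⟨ deg-sum G v ⟩
  sum (link G v)                           ≡⟨ sum-remove (link G v) ⟩
  link G v u + sum (link G v ∘ punchIn u)  ≡⟨ cong (λ x → link G v u + sum (link G x ∘ punchIn u)) (sym w↦v) ⟩
  link G v u + sum (link G (punchIn u w) ∘ punchIn u)
                                           ≡⟨ cong (link G v u +_) (sym (deg-sum (delete G u) w)) ⟩
  link G v u + deg (delete G u) w ∎
  where
  open ≡-Reasoning
  w : Fin n
  w = punchOut u≢v
  w↦v : punchIn u w ≡ v
  w↦v = punchIn-punchOut u≢v

deg-universal : ∀ {n} (G : Graph (suc n)) v → (∀ u → u ≢ v → adj G v u ≡ true) → deg G v ≡ n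
deg-universal {n} G v universal = begin
  deg G v                                   ≡⟨ deg-sum G v ⟩
  sum (link G v)                            ≡⟨ sum-remove (link G v) ⟩
  link G v v + sum (link G v ∘ punchIn v)   ≡⟨ cong₂ _+_ (cong indicator (irrefl G v))
                                                          (sum-cong-≗ (cong indicator ∘ neighbours)) ⟩
  sum (λ (_ : Fin n) → 1)                   ≡⟨ sum-ones n ⟩
  n ∎
  where
  open ≡-Reasoning
  indicator : Bool → ℕ
  indicator b = if b then 1 else 0
  neighbours : ∀ j → adj G v (punchIn v j) ≡ true
  neighbours j = universal (punchIn v j) (punchInᵢ≢i v j)

restrict : ∀ {m n c} (G : Graph n) (f : Fin m → Fin n) {col : Fin n → Fin c} →
  ProperColouring G c col → ProperColouring (induced G f) c (col ∘ f)
restrict G f proper i j = proper (f i) (f j)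

proper-cong : ∀ {n c} (G : Graph n) {col col′ : Fin n → Fin c} → col ≗ col′ →
  ProperColouring G c col → ProperColouring G c col′
proper-cong G eq proper u v e same = proper u v e (trans (eq u) (trans same (sym (eq v))))

proper? : ∀ {n c} (G : Graph n) (col : Fin n → Fin c) → Dec (ProperColouring G c col)
proper? G col = all? λ u → all? λ v → (adj G u v Bool.≟ true) →-dec ¬? (col u ≟ col v)

-- Colourability is decidable: search all c ^ n colour assignments.
colourable? : ∀ {n} (G : Graph n) c → Dec (Colourable G c)
colourable? G c with any? (λ i → proper? G (finToFun i))
... | yes (i , proper) = yes (finToFun i , proper)
... | no none = no λ (col , proper) →
  none (funToFin col , proper-cong G (sym ∘ finToFun-funToFin col) proper)

colourable-mono : ∀ {n d e} (G : Graph n) → d ≤ e → Colourable G d → Colourable G e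
colourable-mono G d≤e (col , proper) =
  (λ x → inject≤ (col x) d≤e) ,
  λ u v e same → proper u v e (inject≤-injective d≤e d≤e (col u) (col v) same)

chromatic : ∀ {n c} (G : Graph n) → Colourable G c → ∃ (IsChromaticNumber G)
chromatic {c = zero}  G col = 0 , col , λ _ _ → z≤n
chromatic {c = suc c} G col with colourable? G c
... | yes col′ = chromatic G col′
... | no ¬col′ = suc c , col , λ d col-d → ≰⇒> (λ d≤c → ¬col′ (colourable-mono G d≤c col-d))

nonempty⇒1≤colours : ∀ {n d} (G : Graph (suc n)) → Colourable G d → 1 ≤ d
nonempty⇒1≤colours {d = zero}  G (col , _) with col zero
... | ()
nonempty⇒1≤colours {d = suc d} G _ = s≤s z≤n

edge⇒2≤colours : ∀ {n d} (G : Graph n) {u v} → adj G u v ≡ true → Colourable G d → 2 ≤ d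
edge⇒2≤colours {d = zero}        G {u} _ (col , _) with col u
... | ()
edge⇒2≤colours {d = suc zero}    G {u} {v} e (col , proper) =
  ⊥-elim (proper u v e (same (col u) (col v)))
  where
  same : (i j : Fin 1) → i ≡ j
  same zero zero = refl
edge⇒2≤colours {d = suc (suc d)} G _ _ = s≤s (s≤s z≤n)

injective⇒surjective : ∀ {n} (f : Fin n → Fin n) → Injective _≡_ _≡_ f → ∀ y → ∃ λ x → f x ≡ y
injective⇒surjective {suc n} f f-inj y with any? (λ x → f x ≟ y)
... | yes hit = hit
... | no miss = ⊥-elim (1+n≰n (injective⇒≤ g-inj))
  where
  avoids : ∀ x → y ≢ f x
  avoids x eq = miss (x , sym eq)
  g : Fin (suc n) → Fin n
  g x = punchOut (avoids x)
  g-inj : Injective _≡_ _≡_ g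
  g-inj eq = f-inj (punchOut-injective (avoids _) (avoids _) eq)

relabel-colouring : ∀ {n d} (G : Graph n) (f : Fin n → Fin n) → Injective _≡_ _≡_ f →
  Colourable (induced G f) d → Colourable G d
relabel-colouring {n} {d} G f f-inj (col , proper) = col ∘ preimage , proper′
  where
  preimage : Fin n → Fin n
  preimage y = proj₁ (injective⇒surjective f f-inj y)
  section : ∀ y → f (preimage y) ≡ y
  section y = proj₂ (injective⇒surjective f f-inj y)
  proper′ : ProperColouring G d (col ∘ preimage)
  proper′ x y e = proper (preimage x) (preimage y)
    (subst₂ (λ a b → adj G a b ≡ true) (sym (section x)) (sym (section y)) e)

drop-colour : ∀ {n c} (G : Graph n) {col : Fin n → Fin (suc c)} {b} →
  ProperColouring G (suc c) col → (∀ x → col x ≢ b) → Colourable G c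
drop-colour G proper unused =
  (λ x → punchOut (unused x ∘ sym)) ,
  λ u v e same → proper u v e (punchOut-injective (unused u ∘ sym) (unused v ∘ sym) same)

record UsedTwice {n c} (col : Fin n → Fin c) (b : Fin c) : Set where
  field
    first second : Fin n
    distinct     : first ≢ second
    first-col    : col first ≡ b
    second-col   : col second ≡ b
open UsedTwice

usedTwice : ∀ {n c} (G : Graph (suc n)) {col : Fin (suc n) → Fin (suc c)} {v} →
  ProperColouring G (suc c) col → ¬ Colourable G c →
  (∀ u → u ≢ v → ¬ Colourable (delete G u) c) →
  ∀ b → b ≢ col v → UsedTwice col b
usedTwice G {col} {v} proper ¬G ¬G-u b b≢col-v with any? (λ x → col x ≟ b)
... | no unused = ⊥-elim (¬G (drop-colour G proper λ x eq → unused (x , eq)))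
... | yes (x , col-x) with any? (λ j → col (punchIn x j) ≟ b)
...   | yes (j , col-j) = record
  { first = x ; second = punchIn x j ; distinct = punchInᵢ≢i x j ∘ sym
  ; first-col = col-x ; second-col = col-j }
...   | no only-x = ⊥-elim (¬G-u x x≢v
  (drop-colour (delete G x) (restrict G (punchIn x) proper) λ j eq → only-x (j , eq)))
  where
  x≢v : x ≢ v
  x≢v refl = b≢col-v (sym col-x)

-- Counting: if each of the c colours other than that of v is used twice, the
-- 2c witnesses are distinct vertices different from v, so 2c ≤ N - 1.
colourCount : ∀ {n c} (col : Fin (suc n) → Fin (suc c)) v →
  (∀ j → UsedTwice col (punchIn (col v) j)) → c + c ≤ n
colourCount {n} {c} col v twice = injective⇒≤ {f = witness} witness-inj
  where
  pick : Fin c ⊎ Fin c → Fin (suc n)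
  pick (inj₁ j) = first (twice j)
  pick (inj₂ j) = second (twice j)
  pick-col : ∀ s → col (pick s) ≡ punchIn (col v) (reduce s)
  pick-col (inj₁ j) = first-col (twice j)
  pick-col (inj₂ j) = second-col (twice j)
  v≢pick : ∀ s → v ≢ pick s
  v≢pick s eq = punchInᵢ≢i (col v) (reduce s) (trans (sym (pick-col s)) (cong col (sym eq)))
  same-colour : ∀ {s s′} → pick s ≡ pick s′ → reduce s ≡ reduce s′
  same-colour {s} {s′} eq =
    punchIn-injective (col v) _ _ (trans (sym (pick-col s)) (trans (cong col eq) (pick-col s′)))
  pick-inj : Injective _≡_ _≡_ pick
  pick-inj {inj₁ j} {inj₁ j′} eq = cong inj₁ (same-colour {inj₁ j} {inj₁ j′} eq)
  pick-inj {inj₂ j} {inj₂ j′} eq = cong inj₂ (same-colour {inj₂ j} {inj₂ j′} eq)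
  pick-inj {inj₁ j} {inj₂ j′} eq with same-colour {inj₁ j} {inj₂ j′} eq
  ... | refl = ⊥-elim (distinct (twice j) eq)
  pick-inj {inj₂ j} {inj₁ j′} eq with same-colour {inj₂ j} {inj₁ j′} eq
  ... | refl = ⊥-elim (distinct (twice j) (sym eq))
  witness : Fin (c + c) → Fin n
  witness i = punchOut (v≢pick (splitAt c i))
  witness-inj : Injective _≡_ _≡_ witness
  witness-inj {i} {i′} eq = begin
    i                      ≡⟨ sym (join-splitAt c c i) ⟩
    join c c (splitAt c i)  ≡⟨ cong (join c c) (pick-inj {splitAt c i} {splitAt c i′}
                                  (punchOut-injective (v≢pick (splitAt c i)) (v≢pick (splitAt c i′)) eq)) ⟩
    join c c (splitAt c i′) ≡⟨ join-splitAt c c i′ ⟩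
    i′ ∎
    where open ≡-Reasoning

criticalBound : ∀ {n c} (G : Graph (suc n)) v → IsChromaticNumber G c →
  (∀ u → u ≢ v → ∀ d → Colourable (delete G u) d → c ≤ d) → c + c ≤ suc (suc n)
criticalBound {c = zero}      G v _ _ = z≤n
criticalBound {n} {c = suc c} G v ((col , proper) , least) keeps =
  s≤s (subst (_≤ suc n) (sym (+-suc c c)) (s≤s (colourCount col v twice)))
  where
  twice : ∀ j → UsedTwice col (punchIn (col v) j)
  twice j = usedTwice G proper (λ col′ → 1+n≰n (least c col′))
    (λ u u≢v col′ → 1+n≰n (keeps u u≢v c col′)) (punchIn (col v) j) (punchInᵢ≢i (col v) j)

Δ-lower : ∀ {k n c} (G : Graph (suc n)) → MinForbidden k G → IsChromaticNumber G c → c + k ≤ Δ G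
Δ-lower {k} {n} {c} G (G∉Υ , minimal) χG with Δ G + 1 ≤? c + k
... | no ¬bound = m<1+n⇒m≤n (subst (c + k <_) (+-comm (Δ G) 1) (≰⇒> ¬bound))
... | yes bound = ⊥-elim (G∉Υ G∈Υ)
  where
  G∈Υ : Upsilon k G
  G∈Υ m f f-inj c′ χH with m≤n⇒m<n∨m≡n (≤-pred (injective⇒≤ f-inj))
  ... | inj₁ m<n  = minimal m f f-inj (s≤s m<n) m id (λ eq → eq) c′ χH
  ... | inj₂ refl = begin
    Δ (induced G f) + 1 ≤⟨ +-monoˡ-≤ 1 (Δ-induced-≤ G f f-inj) ⟩
    Δ G + 1             ≤⟨ bound ⟩
    c + k               ≤⟨ +-monoˡ-≤ k (proj₂ χG c′ (relabel-colouring G f f-inj (proj₁ χH))) ⟩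
    c′ + k ∎
    where open ≤-Reasoning

record DeletionFacts {n} (G : Graph (suc n)) (c k : ℕ) (v u : Fin (suc n)) : Set where
  field
    adjacent : adj G v u ≡ true
    Δ-upper  : Δ G ≤ c + k
    keeps-χ  : ∀ d → Colourable (delete G u) d → c ≤ d
open DeletionFacts

deletion : ∀ {k m c} (G : Graph (suc (suc m))) → MinForbidden k G → IsChromaticNumber G c →
  ∀ {v} → deg G v ≡ Δ G → ∀ {u} → u ≢ v → DeletionFacts G c k v u
deletion {k} {m} {c} G G∈F χG {v} v-max {u} u≢v = record
  { adjacent = v~u ; Δ-upper = Δ≤c+k ; keeps-χ = χ-kept }
  where
  H : Graph (suc m)
  H = delete G u
  colH : Colourable H c
  colH = proj₁ (proj₁ χG) ∘ punchIn u , restrict G (punchIn u) (proj₂ (proj₁ χG))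
  c′ : ℕ
  c′ = proj₁ (chromatic H colH)
  χH : IsChromaticNumber H c′
  χH = proj₂ (chromatic H colH)
  -- H is a proper induced subgraph of G, hence lies in Υ_k.
  H-bound : suc (Δ H) ≤ c′ + k
  H-bound = subst (_≤ c′ + k) (+-comm (Δ H) 1)
    (proj₂ G∈F m (punchIn u) (punchIn-injective u _ _) ≤-refl m id (λ eq → eq) c′ χH)
  c′≤c : c′ ≤ c
  c′≤c = proj₂ χH c colH
  degree-bound : Δ G ≤ link G v u + Δ H
  degree-bound = begin
    Δ G                                   ≡⟨ sym v-max ⟩
    deg G v                               ≡⟨ deg-delete G u≢v ⟩
    link G v u + deg H (punchOut u≢v)     ≤⟨ +-monoʳ-≤ (link G v u) (deg≤Δ H (punchOut u≢v)) ⟩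
    link G v u + Δ H ∎
    where open ≤-Reasoning
  through-H : c + k ≤ link G v u + Δ H
  through-H = ≤-trans (Δ-lower G G∈F χG) degree-bound
  v~u : adj G v u ≡ true
  v~u with adj G v u | through-H
  ... | true  | _       = refl
  ... | false | c+k≤ΔH = ⊥-elim (1+n≰n (≤-trans H-bound (≤-trans (+-monoˡ-≤ k c′≤c) c+k≤ΔH)))
  Δ≤c+k : Δ G ≤ c + k
  Δ≤c+k = ≤-trans degree-bound
    (≤-trans (+-monoˡ-≤ (Δ H) (link≤1 G v u)) (≤-trans H-bound (+-monoˡ-≤ k c′≤c)))
  χ-kept : ∀ d → Colourable H d → c ≤ d
  χ-kept d col-d = ≤-trans (+-cancelʳ-≤ k c c′ c+k≤c′+k) (proj₂ χH d col-d)
    where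
    c+k≤c′+k : c + k ≤ c′ + k
    c+k≤c′+k = ≤-trans through-H (≤-trans (+-monoˡ-≤ (Δ H) (link≤1 G v u)) H-bound)

Δ-one-vertex : (G : Graph 1) → Δ G ≡ 0
Δ-one-vertex G = trans (Δ-maximum G)
  (trans (⊔-identityʳ (deg G zero)) (deg-universal G zero λ { zero 0≢0 → ⊥-elim (0≢0 refl) }))

c≤k+2 : ∀ {c k} → c + c ≤ suc (suc (c + k)) → c ≤ k + 2
c≤k+2 {c} {k} 2c≤ = +-cancelˡ-≤ c c (k + 2) (subst (c + c ≤_) (rearrange c k) 2c≤)
  where
  rearrange : ∀ c k → suc (suc (c + k)) ≡ c + (k + 2)
  rearrange = solve-∀

Δ-bounds : ∀ {D c k} → D ≡ c + k → c ≤ k + 2 → (2 * c ∸ 2 ≤ D) × (D ≤ 2 * k + 2)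
Δ-bounds {c = c} {k} refl c≤ =
  m≤n+o⇒m∸n≤o (2 * c) 2 (subst₂ _≤_ (double c) (shift c k) (+-monoʳ-≤ c c≤)) ,
  subst (c + k ≤_) (total k) (+-monoˡ-≤ k c≤)
  where
  double : ∀ c → c + c ≡ 2 * c
  double = solve-∀
  shift : ∀ c k → c + (k + 2) ≡ 2 + (c + k)
  shift = solve-∀
  total : ∀ k → k + 2 + k ≡ 2 * k + 2
  total = solve-∀

proposition1 : (k n : ℕ) (G : Graph (suc n)) → MinForbidden k G →
    (c : ℕ) → IsChromaticNumber G c →
    ((2 * c ∸ 2 ≤ Δ G) × (Δ G ≤ 2 * k + 2)) × ((2 ≤ c) × (c ≤ k + 2))
-- A single vertex would give 1 ≤ c ≤ c + k ≤ Δ G = 0.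
proposition1 k zero G G∈F c χG
  with ≤-trans (nonempty⇒1≤colours G (proj₁ χG))
         (≤-trans (m≤m+n c k) (subst (c + k ≤_) (Δ-one-vertex G) (Δ-lower G G∈F χG)))
... | ()
proposition1 k (suc m) G G∈F c χG = Δ-bounds Δ≡c+k c≤ , 2≤c , c≤
  where
  v : Fin (suc (suc m))
  v = proj₁ (maxDegreeVertex G)
  v-max : deg G v ≡ Δ G
  v-max = proj₂ (maxDegreeVertex G)
  facts : ∀ u → u ≢ v → DeletionFacts G c k v u
  facts u u≢v = deletion G G∈F χG v-max u≢v
  some-u : DeletionFacts G c k v (punchIn v zero)
  some-u = facts (punchIn v zero) (punchInᵢ≢i v zero)
  Δ≡c+k : Δ G ≡ c + k
  Δ≡c+k = ≤-antisym (Δ-upper some-u) (Δ-lower G G∈F χG)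
  Δ≡N-1 : Δ G ≡ suc m
  Δ≡N-1 = trans (sym v-max) (deg-universal G v λ u u≢v → adjacent (facts u u≢v))
  2≤c : 2 ≤ c
  2≤c = edge⇒2≤colours G (adjacent some-u) (proj₁ χG)
  c≤ : c ≤ k + 2
  c≤ = c≤k+2 (subst (λ n → c + c ≤ suc (suc n)) (trans (sym Δ≡N-1) Δ≡c+k)
    (criticalBound G v χG λ u u≢v → keeps-χ (facts u u≢v)))
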